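{- Let $\Sigma$ be a finite alphabet. For every $k \in \mathbb{N}$, every word $w \in \Sigma^*$ and every $w' \in B(w,k)$, \[ C_{\mathrm{LZ77}}(w') \le 3\cdot C_{\mathrm{LZ77}}(w) + 4k. \]
   Context: For a word $w = w_1 w_2 \cdots w_n$ over a finite alphabet $\Sigma$, write $w[i:j] = w_i w_{i+1}\cdots w_j$. The LZ77 factorization of $w$ is the decomposition $w = P_1 P_2 \cdots P_z$ computed greedily from left to right: if the prefix $w[1:m]$ has already been parsed, the next phrase is the shortest non-empty prefix of the remaining suffix $w[m+1:n]$ that does not occur as a (contiguous) substring of $w[1:m]$; if no such prefix exists, the next phrase is the whole remaining suffix $w[m+1:n]$. Then $m$ is increased by the length of the phrase and the process repeats until $m=n$. $C_{\mathrm{LZ77}}(w) = z$ denotes the number of phrases. For $w,w' \in \Sigma^n$, the Hamming distance is $\Delta(w,w') = |\{i : w_i \ne w'_i\}|$, and $B(w,k) = \{w' \in \Sigma^{|w|} : \Delta(w,w') \le k\}$. -}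

module Defs where

open import Data.Nat using (ℕ; zero; suc; _+_)
open import Data.Fin using (Fin)
import Data.Fin as Fin
open import Data.List using (List; []; _∷_; length; take; drop; _++_)
open import Data.Bool using (Bool; true; false; if_then_else_)
open import Relation.Binary.PropositionalEquality using (_≡_)
open import Relation.Nullary.Decidable using (does)
open import Data.List.Relation.Binary.Infix.Heterogeneous using (Infix)
open import Data.List.Relation.Binary.Infix.Heterogeneous.Properties using (infix?)

-- A finite alphabet Σ is represented as Fin q (any finite set is in bijection
-- with some Fin q); words are lists over it.
Word : ℕ → Set
Word q = List (Fin q)

occurs? : ∀ {q} → Word q → Word q → Bool
occurs? u v = does (infix? Fin._≟_ u v)

phraseLen : ∀ {q} → Word q → Word q → ℕ
phraseLen {q} done rest = go 1 (length rest)
  where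
  go : ℕ → ℕ → ℕ
  go ℓ zero    = length rest
  go ℓ (suc r) = if occurs? (take ℓ rest) done then go (suc ℓ) r else ℓ

-- The fuel argument is the length of the remaining suffix
-- (each phrase has length ≥ 1, so fuel never runs out first).
lzCount : ∀ {q} → ℕ → Word q → Word q → ℕ
lzCount zero    done rest     = 0
lzCount (suc f) done []       = 0
lzCount (suc f) done (x ∷ xs) =
  let ℓ = phraseLen done (x ∷ xs) in
  suc (lzCount f (done ++ take ℓ (x ∷ xs)) (drop ℓ (x ∷ xs)))

C-LZ77 : ∀ {q} → Word q → ℕ
C-LZ77 w = lzCount (length w) [] w

-- Hamming distance between two words (positions where they differ);
-- only used for words of equal length.
hamming : ∀ {q} → Word q → Word q → ℕ
hamming []       _        = 0
hamming (_ ∷ _)  []       = 0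
hamming (x ∷ xs) (y ∷ ys) = (if does (x Fin.≟ y) then 0 else 1) + hamming xs ys

data _∈B[_,_] {q : ℕ} (w' : Word q) (w : Word q) (k : ℕ) : Set where
  inBall : length w' ≡ length w → hamming w w' Data.Nat.≤ k → w' ∈B[ w , k ]

-- Call a position an anchor if it ends a phrase of w or if w and w′ differ
-- there: there are at most C(w) + k anchors, and a phrase of w′ containing one is charged 3 to it.
-- An anchor-free phrase w′[s, s + ℓ) lies inside a phrase of w and agrees with w, so it equals
-- the matching window of the earlier source of that phrase of w. Being new in w′, the phrase
-- forces that window to contain a mismatch and not to lie strictly between two mismatches whose
-- surrounding text of w has already been transcribed into w′. Consecutive anchor-free phrases
-- form a run reading consecutive source windows; the first two phrases of a run are paid by the
-- 2 credits left by the preceding anchored phrase, and each later one removes a right end of a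
-- maximal interval of known mismatch indices, of which there are at most k. Hence
-- C(w′) ≤ 3 (C(w) + k) + k.

module Submission where

open import Defs
open import Data.Bool using (Bool; true; false; T; if_then_else_)
open import Data.Empty using (⊥-elim)
import Data.Fin.Properties as Fin
open import Data.List using (List; []; _∷_; length; take; drop; _++_)
open import Data.List.Properties using (length-take; length-drop; take-[]; drop-drop; drop-all)
open import Data.List.Relation.Binary.Infix.Heterogeneous using (Infix; here; there)
open import Data.List.Relation.Binary.Infix.Heterogeneous.Properties using (infix?)
open import Data.List.Relation.Binary.Prefix.Heterogeneous using (Prefix; []; _∷_)
import Data.List.Relation.Binary.Prefix.Heterogeneous.Properties as Prefix
open import Data.List.Relation.Unary.Any using (Any; here; there; any?)
open import Data.Maybe using (Maybe; just; nothing)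
open import Data.Maybe.Properties using (just-injective; ≡-dec)
open import Data.Nat
open import Data.Nat.Properties
open import Data.Nat.Tactic.RingSolver using (solve-∀)
open import Data.Product using (Σ; ∃; _×_; _,_; proj₁; proj₂)
open import Data.Sum using (_⊎_; inj₁; inj₂; [_,_]; map₂)
open import Data.Unit using (⊤; tt)
open import Function.Base using (_∋_; _∘_)
open import Level using (0ℓ)
open import Relation.Binary.Definitions using (Tri; tri<; tri≈; tri>)
open import Relation.Binary.PropositionalEquality hiding ([_])
open import Relation.Nullary using (¬_; Dec; yes; no; does; contradiction; _×-dec_; _⊎-dec_; ¬?)
open import Relation.Nullary.Decidable using (T?; decidable-stable)
open import Relation.Unary using (Pred; Decidable; _∪_)
open import Relation.Unary.Properties using (_∪?_)

-- Positions and occurrences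

suc[ℓ∸1]≡ℓ : ∀ {ℓ} → 1 ≤ ℓ → suc (ℓ ∸ 1) ≡ ℓ
suc[ℓ∸1]≡ℓ (s≤s z≤n) = refl

∸1< : ∀ {ℓ} → 1 ≤ ℓ → ℓ ∸ 1 < ℓ
∸1< 1≤ℓ = ≤-reflexive (suc[ℓ∸1]≡ℓ 1≤ℓ)

at : ∀ {A : Set} → List A → ℕ → Maybe A
at []       _       = nothing
at (x ∷ xs) zero    = just x
at (x ∷ xs) (suc i) = at xs i

module _ {A : Set} where

  at-take : ∀ (xs : List A) {m i} → i < m → at (take m xs) i ≡ at xs i
  at-take xs       {zero}          ()
  at-take []       {suc m}         _   = refl
  at-take (x ∷ xs) {suc m} {zero}  _   = refl
  at-take (x ∷ xs) {suc m} {suc i} i<m = at-take xs (s≤s⁻¹ i<m)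

  at-drop : ∀ (xs : List A) m i → at (drop m xs) i ≡ at xs (m + i)
  at-drop xs       zero    i = refl
  at-drop []       (suc m) i = refl
  at-drop (x ∷ xs) (suc m) i = at-drop xs m i

  at-take-drop : ∀ (xs : List A) m {ℓ t} → t < ℓ → at (take ℓ (drop m xs)) t ≡ at xs (m + t)
  at-take-drop xs m {t = t} t<ℓ = trans (at-take (drop m xs) t<ℓ) (at-drop xs m t)

  length-take-≤ : ∀ (xs : List A) {m} → m ≤ length xs → length (take m xs) ≡ m
  length-take-≤ xs {m} m≤ = trans (length-take m xs) (m≤n⇒m⊓n≡m m≤)

  length-take-drop : ∀ (xs : List A) m ℓ → m + ℓ ≤ length xs → length (take ℓ (drop m xs)) ≡ ℓ
  length-take-drop xs m ℓ fits = length-take-≤ (drop m xs)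
    (subst (ℓ ≤_) (sym (length-drop m xs)) (subst (_≤ length xs ∸ m) (m+n∸m≡n m ℓ) (∸-monoˡ-≤ m fits)))

  take-++-take-drop : ∀ m ℓ (xs : List A) → take m xs ++ take ℓ (drop m xs) ≡ take (m + ℓ) xs
  take-++-take-drop zero    ℓ xs       = refl
  take-++-take-drop (suc m) ℓ []       = take-[] ℓ
  take-++-take-drop (suc m) ℓ (x ∷ xs) = cong (x ∷_) (take-++-take-drop m ℓ xs)

  OccursIn : List A → List A → Set
  OccursIn u v = Σ ℕ λ g → g + length u ≤ length v × (∀ t → t < length u → at v (g + t) ≡ at u t)

  prefix⇒agrees : ∀ {u v : List A} → Prefix _≡_ u v → ∀ t → t < length u → at v t ≡ at u t
  prefix⇒agrees (refl ∷ p) zero    _   = refl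
  prefix⇒agrees (refl ∷ p) (suc t) t<u = prefix⇒agrees p t (s≤s⁻¹ t<u)

  agrees⇒prefix : ∀ (u v : List A) → length u ≤ length v → (∀ t → t < length u → at v t ≡ at u t) → Prefix _≡_ u v
  agrees⇒prefix []      v       _ _     = []
  agrees⇒prefix (x ∷ u) (y ∷ v) u≤v agree =
    sym (just-injective (agree zero z<s)) ∷ agrees⇒prefix u v (s≤s⁻¹ u≤v) (λ t t<u → agree (suc t) (s<s t<u))

  infix⇒occursIn : ∀ {u v : List A} → Infix _≡_ u v → OccursIn u v
  infix⇒occursIn (here p)  = 0 , Prefix.length-mono p , prefix⇒agrees p
  infix⇒occursIn (there i) with g , fits , agree ← infix⇒occursIn i = suc g , s≤s fits , agree

  occursIn⇒infix : ∀ (u v : List A) → OccursIn u v → Infix _≡_ u v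
  occursIn⇒infix u v       (zero  , fits , agree) = here (agrees⇒prefix u v fits agree)
  occursIn⇒infix u (y ∷ v) (suc g , fits , agree) = there (occursIn⇒infix u v (g , s≤s⁻¹ fits , agree))

  OccursBefore : List A → ℕ → ℕ → Set
  OccursBefore w m ℓ = Σ ℕ λ g → g + ℓ ≤ m × (∀ t → t < ℓ → at w (g + t) ≡ at w (m + t))

  module _ (w : List A) (m ℓ : ℕ) (fits : m + ℓ ≤ length w) where

    private
      |prefix| : length (take m w) ≡ m
      |prefix| = length-take-≤ w (≤-trans (m≤m+n m ℓ) fits)

      |factor| : length (take ℓ (drop m w)) ≡ ℓ
      |factor| = length-take-drop w m ℓ fits

    occursIn⇒occursBefore : OccursIn (take ℓ (drop m w)) (take m w) → OccursBefore w m ℓ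
    occursIn⇒occursBefore (g , g+ℓ≤m , agree) = g , g+ℓ≤m′ , agree′
      where
      g+ℓ≤m′ : g + ℓ ≤ m
      g+ℓ≤m′ = subst₂ (λ a b → g + a ≤ b) |factor| |prefix| g+ℓ≤m
      agree′ : ∀ t → t < ℓ → at w (g + t) ≡ at w (m + t)
      agree′ t t<ℓ = begin
        at w (g + t)                ≡⟨ at-take w (<-≤-trans (+-monoʳ-< g t<ℓ) g+ℓ≤m′) ⟨
        at (take m w) (g + t)       ≡⟨ agree t (subst (t <_) (sym |factor|) t<ℓ) ⟩
        at (take ℓ (drop m w)) t    ≡⟨ at-take-drop w m t<ℓ ⟩
        at w (m + t)                ∎
        where open ≡-Reasoning

    occursBefore⇒occursIn : OccursBefore w m ℓ → OccursIn (take ℓ (drop m w)) (take m w)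
    occursBefore⇒occursIn (g , g+ℓ≤m , agree) = g , subst₂ (λ a b → g + a ≤ b) (sym |factor|) (sym |prefix|) g+ℓ≤m , agree′
      where
      agree′ : ∀ t → t < length (take ℓ (drop m w)) → at (take m w) (g + t) ≡ at (take ℓ (drop m w)) t
      agree′ t t<|factor| = begin
        at (take m w) (g + t)       ≡⟨ at-take w (<-≤-trans (+-monoʳ-< g t<ℓ) g+ℓ≤m) ⟩
        at w (g + t)                ≡⟨ agree t t<ℓ ⟩
        at w (m + t)                ≡⟨ at-take-drop w m t<ℓ ⟨
        at (take ℓ (drop m w)) t    ∎
        where
        open ≡-Reasoning
        t<ℓ : t < ℓ
        t<ℓ = subst (t <_) |factor| t<|factor|

  module _ (w : List A) where

    occursBefore-suffix : ∀ {m ℓ a} → m ≤ a → a ≤ m + ℓ → OccursBefore w m ℓ → OccursBefore w a (m + ℓ ∸ a)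
    occursBefore-suffix {m} {ℓ} m≤a a≤m+ℓ (g , g+ℓ≤m , agree) with i , refl ← m≤n⇒∃[o]m+o≡n m≤a
      rewrite [m+n]∸[m+o]≡n∸o m ℓ i = g + i , fits , agree′
      where
      i≤ℓ : i ≤ ℓ
      i≤ℓ = +-cancelˡ-≤ m i ℓ a≤m+ℓ
      fits : g + i + (ℓ ∸ i) ≤ m + i
      fits = begin
        g + i + (ℓ ∸ i)   ≡⟨ +-assoc g i (ℓ ∸ i) ⟩
        g + (i + (ℓ ∸ i)) ≡⟨ cong (g +_) (m+[n∸m]≡n i≤ℓ) ⟩
        g + ℓ             ≤⟨ g+ℓ≤m ⟩
        m                 ≤⟨ m≤m+n m i ⟩
        m + i             ∎
        where open ≤-Reasoning
      agree′ : ∀ t → t < ℓ ∸ i → at w (g + i + t) ≡ at w (m + i + t)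
      agree′ t t<ℓ-i = begin
        at w (g + i + t)   ≡⟨ cong (at w) (+-assoc g i t) ⟩
        at w (g + (i + t)) ≡⟨ agree (i + t) (subst (i + t <_) (m+[n∸m]≡n i≤ℓ) (+-monoʳ-< i t<ℓ-i)) ⟩
        at w (m + (i + t)) ≡⟨ cong (at w) (+-assoc m i t) ⟨
        at w (m + i + t)   ∎
        where open ≡-Reasoning

-- The greedy phrase

module _ {q : ℕ} where

  occurs?-true : ∀ (u v : Word q) → occurs? u v ≡ true → OccursIn u v
  occurs?-true u v eq with infix? Fin._≟_ u v
  ... | yes u∈v = infix⇒occursIn u∈v

  occurs?-false : ∀ (u v : Word q) → occurs? u v ≡ false → ¬ OccursIn u v
  occurs?-false u v eq occ with infix? Fin._≟_ u v
  ... | no u∉v = u∉v (occursIn⇒infix u v occ)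

  -- The search loop of phraseLen is local to it; a metavariable solved by refl gives it a name.
  private
    loop-named : (d r : Word q) → let go = (ℕ → ℕ → ℕ) ∋ _ in
      Σ (ℕ → ℕ → ℕ) (_≡ go) × (phraseLen d r ≡ go 1 (length r))
    loop-named d r with 1 | length r
    ... | _ | _ = (_ , refl) , refl

  search : Word q → Word q → ℕ → ℕ → ℕ
  search d r = proj₁ (proj₁ (loop-named d r))

  record ShortestNew (d r : Word q) (v : ℕ) : Set where
    field
      nonempty : 1 ≤ v
      bounded  : v ≤ length r
      copied   : OccursIn (take (v ∸ 1) r) d
      new      : v < length r → ¬ OccursIn (take v r) d

  search-shortestNew : ∀ (d r : Word q) → 1 ≤ length r → ∀ ℓ m → 1 ≤ ℓ → ℓ + m ≡ suc (length r) →
    (∀ j → j < ℓ → OccursIn (take j r) d) → ShortestNew d r (search d r ℓ m)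
  search-shortestNew d r r≢[] ℓ zero ℓ≥1 ℓ+0≡1+|r| occ = record
    { nonempty = r≢[]
    ; bounded  = ≤-refl
    ; copied   = occ (length r ∸ 1) (subst (length r ∸ 1 <_) (sym (trans (sym (+-identityʳ ℓ)) ℓ+0≡1+|r|)) (s≤s (m∸n≤m (length r) 1)))
    ; new      = λ r<r → ⊥-elim (<-irrefl refl r<r)
    }
  search-shortestNew d r r≢[] ℓ (suc m) ℓ≥1 ℓ+1+m≡1+|r| occ with occurs? (take ℓ r) d in eq
  ... | true  = search-shortestNew d r r≢[] (suc ℓ) m z<s (trans (sym (+-suc ℓ m)) ℓ+1+m≡1+|r|) occ′
    where
    occ′ : ∀ j → j < suc ℓ → OccursIn (take j r) d
    occ′ j j<1+ℓ with m≤n⇒m<n∨m≡n {j} {ℓ} (s≤s⁻¹ j<1+ℓ)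
    ... | inj₁ j<ℓ  = occ j j<ℓ
    ... | inj₂ refl = occurs?-true (take ℓ r) d eq
  ... | false = record
    { nonempty = ℓ≥1
    ; bounded  = subst (ℓ ≤_) (suc-injective (trans (sym (+-suc ℓ m)) ℓ+1+m≡1+|r|)) (m≤m+n ℓ m)
    ; copied   = occ (ℓ ∸ 1) (∸1< ℓ≥1)
    ; new      = λ _ → occurs?-false (take ℓ r) d eq
    }

  phraseAt : Word q → ℕ → ℕ
  phraseAt w m = phraseLen (take m w) (drop m w)

  record Phrase (w : Word q) (m ℓ : ℕ) : Set where
    field
      nonempty : 1 ≤ ℓ
      fits     : m + ℓ ≤ length w
      copied   : OccursBefore w m (ℓ ∸ 1)
      new      : m + ℓ < length w → ¬ OccursBefore w m ℓ

  phraseAt-phrase : ∀ (w : Word q) {m} → m < length w → Phrase w m (phraseAt w m)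
  phraseAt-phrase w {m} m<n = record
    { nonempty = nonempty
    ; fits     = fits
    ; copied   = occursIn⇒occursBefore w m (ℓ ∸ 1) (≤-trans (+-monoʳ-≤ m (m∸n≤m ℓ 1)) fits) copied
    ; new      = λ m+ℓ<n → new (ℓ<|r| m+ℓ<n) ∘ occursBefore⇒occursIn w m ℓ fits
    }
    where
    ℓ = phraseAt w m
    |r| : length (drop m w) ≡ length w ∸ m
    |r| = length-drop m w
    shortest : ShortestNew (take m w) (drop m w) ℓ
    shortest = search-shortestNew (take m w) (drop m w) (subst (1 ≤_) (sym |r|) (m<n⇒0<n∸m m<n)) 1 _ ≤-refl refl
      λ { zero _ → 0 , z≤n , λ _ () ; (suc j) (s≤s ()) }
    open ShortestNew shortest
    fits : m + ℓ ≤ length w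
    fits = subst (m + ℓ ≤_) (m+[n∸m]≡n (<⇒≤ m<n)) (+-monoʳ-≤ m (subst (ℓ ≤_) |r| bounded))
    ℓ<|r| : m + ℓ < length w → ℓ < length (drop m w)
    ℓ<|r| m+ℓ<n = subst (ℓ <_) (sym |r|) (subst (_< length w ∸ m) (m+n∸m≡n m ℓ) (∸-monoˡ-< m+ℓ<n (m≤m+n m ℓ)))

  lzFrom : Word q → ℕ → ℕ → ℕ
  lzFrom w f m = lzCount f (take m w) (drop m w)

  private
    lzCount-∷ : ∀ f (d r : Word q) → r ≢ [] →
      lzCount (suc f) d r ≡ suc (lzCount f (d ++ take (phraseLen d r) r) (drop (phraseLen d r) r))
    lzCount-∷ f d []      r≢[] = ⊥-elim (r≢[] refl)
    lzCount-∷ f d (x ∷ r) _    = refl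

    lzCount-[] : ∀ f (d : Word q) → lzCount f d [] ≡ 0
    lzCount-[] zero    d = refl
    lzCount-[] (suc f) d = refl

  lzFrom-step : ∀ (w : Word q) f {m} → m < length w → lzFrom w (suc f) m ≡ suc (lzFrom w f (m + phraseAt w m))
  lzFrom-step w f {m} m<n = trans (lzCount-∷ f (take m w) (drop m w) rest≢[])
    (cong suc (cong₂ (lzCount f) (take-++-take-drop m (phraseAt w m) w) (drop-drop m (phraseAt w m) w)))
    where
    rest≢[] : drop m w ≢ []
    rest≢[] eq = <-irrefl (trans (sym (cong length eq)) (length-drop m w)) (m<n⇒0<n∸m m<n)

  lzFrom-done : ∀ (w : Word q) f {m} → length w ≤ m → lzFrom w f m ≡ 0
  lzFrom-done w f {m} n≤m rewrite drop-all m w n≤m = lzCount-[] f (take m w)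

-- Counting

count : {P : Pred ℕ 0ℓ} → Decidable P → ℕ → ℕ
count P? zero = zero
count P? (suc n) with P? n
... | yes _ = suc (count P? n)
... | no  _ = count P? n

private
  below : ∀ {A : Pred ℕ 0ℓ} {n} → (∀ {i} → i < suc n → A i) → ∀ {i} → i < n → A i
  below A<1+n i<n = A<1+n (m<n⇒m<1+n i<n)

module _ {P : Pred ℕ 0ℓ} (P? : Decidable P) where

  count-≤ : ∀ n → count P? n ≤ n
  count-≤ zero = z≤n
  count-≤ (suc n) with P? n
  ... | yes _ = s≤s (count-≤ n)
  ... | no  _ = m≤n⇒m≤1+n (count-≤ n)

  count-shift : ∀ n → count P? (suc n) ≡ count P? 1 + count (λ i → P? (suc i)) n
  count-shift zero = sym (+-identityʳ _)
  count-shift (suc n) with P? (suc n)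
  ... | yes _ = trans (cong suc (count-shift n)) (sym (+-suc _ _))
  ... | no  _ = count-shift n

  count-< : ∀ {c n} → c < n → ¬ P c → count P? n < n
  count-< {c} {suc n} c<1+n ¬Pc with P? n | m≤n⇒m<n∨m≡n (s≤s⁻¹ c<1+n)
  ... | yes _  | inj₁ c<n  = s<s (count-< c<n ¬Pc)
  ... | yes Pn | inj₂ refl = contradiction Pn ¬Pc
  ... | no  _  | inj₁ c<n  = m<n⇒m<1+n (count-< c<n ¬Pc)
  ... | no  _  | inj₂ refl = s≤s (count-≤ n)

  count-none : ∀ {n} → (∀ {i} → i < n → ¬ P i) → count P? n ≡ 0
  count-none {zero}  _    = refl
  count-none {suc n} ¬P<n with P? n
  ... | yes Pn = contradiction Pn (¬P<n ≤-refl)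
  ... | no  _  = count-none (below ¬P<n)

  count-monoʳ : ∀ {m n} → m ≤ n → count P? m ≤ count P? n
  count-monoʳ {n = zero}  z≤n = ≤-refl
  count-monoʳ {m} {suc n} m≤1+n with m≤n⇒m<n∨m≡n m≤1+n
  ... | inj₂ refl = ≤-refl
  ... | inj₁ m<1+n with P? n
  ...   | yes _ = m≤n⇒m≤1+n (count-monoʳ (s≤s⁻¹ m<1+n))
  ...   | no  _ = count-monoʳ (s≤s⁻¹ m<1+n)

  count-flat : ∀ {a b p} → a ≤ p → p < b → count P? b ≤ count P? a → ¬ P p
  count-flat {a} {b} {p} a≤p p<b flat Pp = <-irrefl refl (begin-strict
    count P? a        ≤⟨ count-monoʳ a≤p ⟩
    count P? p        <⟨ count-step ⟩
    count P? (suc p)  ≤⟨ count-monoʳ p<b ⟩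
    count P? b        ≤⟨ flat ⟩
    count P? a        ∎)
    where
    open ≤-Reasoning
    count-step : count P? p < count P? (suc p)
    count-step with P? p
    ... | yes _  = ≤-refl
    ... | no ¬Pp = contradiction Pp ¬Pp

module _ {P Q : Pred ℕ 0ℓ} (P? : Decidable P) (Q? : Decidable Q) where

  count-mono : ∀ {n} → (∀ {i} → i < n → P i → Q i) → count P? n ≤ count Q? n
  count-mono {zero}  _   = z≤n
  count-mono {suc n} P⊆Q with P? n | Q? n
  ... | yes _  | yes _  = s≤s (count-mono (below P⊆Q))
  ... | yes Pn | no ¬Qn = contradiction (P⊆Q ≤-refl Pn) ¬Qn
  ... | no  _  | yes _  = m≤n⇒m≤1+n (count-mono (below P⊆Q))
  ... | no  _  | no  _  = count-mono (below P⊆Q)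

  count-strict : ∀ {n c} → (∀ {i} → i < n → P i → Q i) → c < n → Q c → ¬ P c → suc (count P? n) ≤ count Q? n
  count-strict {suc n} P⊆Q c<1+n Qc ¬Pc with m≤n⇒m<n∨m≡n (s≤s⁻¹ c<1+n) | P? n | Q? n
  ... | _         | yes Pn | no ¬Qn = contradiction (P⊆Q ≤-refl Pn) ¬Qn
  ... | inj₂ refl | yes Pn | _      = contradiction Pn ¬Pc
  ... | inj₂ refl | no  _  | no ¬Qn = contradiction Qc ¬Qn
  ... | inj₂ refl | no  _  | yes _  = s≤s (count-mono (below P⊆Q))
  ... | inj₁ c<n  | yes _  | yes _  = s≤s (count-strict (below P⊆Q) c<n Qc ¬Pc)
  ... | inj₁ c<n  | no  _  | yes _  = m≤n⇒m≤1+n (count-strict (below P⊆Q) c<n Qc ¬Pc)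
  ... | inj₁ c<n  | no  _  | no  _  = count-strict (below P⊆Q) c<n Qc ¬Pc

  count-insert : ∀ {n q} → (∀ {i} → i < n → i ≢ q → P i → Q i) → count P? n ≤ suc (count Q? n)
  count-insert {zero}      _       = z≤n
  count-insert {suc n} {q} P⊆Q∪q with P? n | Q? n
  ... | yes _  | yes _  = s≤s (count-insert (below P⊆Q∪q))
  ... | no  _  | yes _  = m≤n⇒m≤1+n (count-insert (below P⊆Q∪q))
  ... | no  _  | no  _  = count-insert (below P⊆Q∪q)
  ... | yes Pn | no ¬Qn with n ≟ q
  ...   | yes refl = s≤s (count-mono (λ i<n → below P⊆Q∪q i<n (λ { refl → <-irrefl refl i<n })))
  ...   | no  n≢q  = contradiction (P⊆Q∪q ≤-refl n≢q Pn) ¬Qn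

module _ {P Q : Pred ℕ 0ℓ} (P? : Decidable P) (Q? : Decidable Q) where

  count-exchange : ∀ {n q r} → (∀ {i} → i < n → i ≢ q → P i → Q i) → r < n → Q r → r ≡ q ⊎ ¬ P r →
    count P? n ≤ count Q? n
  count-exchange {n} {q} {r} P⊆Q∪q r<n Qr r≡q⊎¬Pr with r ≟ q | r≡q⊎¬Pr
  ... | yes refl | _        = count-mono P? Q? P⊆Q
    where
    P⊆Q : ∀ {i} → i < n → P i → Q i
    P⊆Q {i} i<n Pi with i ≟ r
    ... | yes refl = Qr
    ... | no  i≢r  = P⊆Q∪q i<n i≢r Pi
  ... | no r≢q | inj₁ r≡q = contradiction r≡q r≢q
  ... | no r≢q | inj₂ ¬Pr = s≤s⁻¹ (begin
    suc (count P? n)          ≤⟨ count-strict P? (P? ∪? (_≟ r)) (λ _ → inj₁) r<n (inj₂ refl) ¬Pr ⟩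
    count (P? ∪? (_≟ r)) n    ≤⟨ count-insert (P? ∪? (_≟ r)) Q? P∪r⊆Q∪q ⟩
    suc (count Q? n)          ∎)
    where
    open ≤-Reasoning
    P∪r⊆Q∪q : ∀ {i} → i < n → i ≢ q → (P ∪ (_≡ r)) i → Q i
    P∪r⊆Q∪q i<n i≢q (inj₁ Pi)   = P⊆Q∪q i<n i≢q Pi
    P∪r⊆Q∪q i<n i≢q (inj₂ refl) = Qr

module _ {P Q R : Pred ℕ 0ℓ} (P? : Decidable P) (Q? : Decidable Q) (R? : Decidable R) where

  count-∪ : ∀ {n} → (∀ {i} → i < n → P i → Q i ⊎ R i) → count P? n ≤ count Q? n + count R? n
  count-∪ {n} P⊆Q∪R = ≤-trans (count-mono P? (Q? ∪? R?) P⊆Q∪R) (count-∪≤+ n)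
    where
    count-∪≤+ : ∀ n → count (Q? ∪? R?) n ≤ count Q? n + count R? n
    count-∪≤+ zero = z≤n
    count-∪≤+ (suc n) with Q? n | R? n
    ... | yes _ | yes _ = s≤s (≤-trans (count-∪≤+ n) (+-monoʳ-≤ (count Q? n) (n≤1+n _)))
    ... | yes _ | no  _ = s≤s (count-∪≤+ n)
    ... | no  _ | yes _ = ≤-trans (s≤s (count-∪≤+ n)) (≤-reflexive (sym (+-suc _ _)))
    ... | no  _ | no  _ = count-∪≤+ n

-- Known intervals of mismatch indices

crossing : ∀ {P : Pred ℕ 0ℓ} → Decidable P → ∀ {m m′} → m ≤ m′ → P m → ¬ P m′ →
  ∃ λ b → m ≤ b × b < m′ × P b × ¬ P (suc b)
crossing P? {m} {zero}   z≤n    Pm ¬Pm′  = contradiction Pm ¬Pm′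
crossing P? {m} {suc m′} m≤1+m′ Pm ¬P1+m′ with m≤n⇒m<n∨m≡n m≤1+m′
... | inj₂ refl   = contradiction Pm ¬P1+m′
... | inj₁ m<1+m′ with P? m′
...   | yes Pm′ = m′ , s≤s⁻¹ m<1+m′ , ≤-refl , Pm′ , ¬P1+m′
...   | no ¬Pm′ with b , m≤b , b<m′ , Pb , ¬Pb+1 ← crossing P? (s≤s⁻¹ m<1+m′) Pm ¬Pm′ =
  b , m≤b , m<n⇒m<1+n b<m′ , Pb , ¬Pb+1

Interval : Set
Interval = ℕ × ℕ

Covers : ℕ → ℕ → Interval → Set
Covers a b (p , q) = p ≤ a × b ≤ q

Covered : List Interval → ℕ → ℕ → Set
Covered L a b = Any (Covers a b) L

Known : List Interval → ℕ → ℕ → Set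
Known L a b = a < b × (b ≡ suc a ⊎ Covered L a b)

Known? : ∀ L a b → Dec (Known L a b)
Known? L a b = (a <? b) ×-dec ((b ≟ suc a) ⊎-dec any? (λ { (p , q) → (p ≤? a) ×-dec (b ≤? q) }) L)

Boundary : List Interval → ℕ → Set
Boundary L b = ∃ λ a → a < b × (Known L a b × ¬ Known L a (suc b))

Boundary? : ∀ L → Decidable (Boundary L)
Boundary? L b = anyUpTo? (λ a → Known? L a b ×-dec ¬? (Known? L a (suc b))) b

potential : List Interval → ℕ → ℕ
potential L k = count (Boundary? L) (suc k)

Confined : List Interval → ℕ → ℕ → Set
Confined L x y = ∀ {a b} → Known L a b → a < x → b ≤ y

module _ {L : List Interval} where

  potential-≤ : ∀ k → potential L k ≤ k
  potential-≤ k = s≤s⁻¹ (count-< (Boundary? L) {0} z<s λ ())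

  Known-shrink : ∀ {a b a′ b′} → Known L a b → a ≤ a′ → a′ < b′ → b′ ≤ b → Known L a′ b′
  Known-shrink (a<b , inj₁ refl) a≤a′ a′<b′ b′≤b =
    a′<b′ , inj₁ (≤-antisym (≤-trans b′≤b (s≤s a≤a′)) a′<b′)
  Known-shrink (a<b , inj₂ cov) a≤a′ a′<b′ b′≤b = a′<b′ , inj₂ (shrink cov)
    where
    shrink : ∀ {L} → Covered L _ _ → Covered L _ _
    shrink (here (p≤a , b≤q)) = here (≤-trans p≤a a≤a′ , ≤-trans b′≤b b≤q)
    shrink (there cov)        = there (shrink cov)

  Known-∷ : ∀ {I a b} → Known L a b → Known (I ∷ L) a b
  Known-∷ (a<b , inj₁ b≡1+a) = a<b , inj₁ b≡1+a
  Known-∷ (a<b , inj₂ cov)   = a<b , inj₂ (there cov)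

  Known-∷⁻ : ∀ {I a b} → Known (I ∷ L) a b → Known L a b ⊎ Covers a b I
  Known-∷⁻ (a<b , inj₁ b≡1+a)   = inj₁ (a<b , inj₁ b≡1+a)
  Known-∷⁻ (a<b , inj₂ (here c)) = inj₂ c
  Known-∷⁻ (a<b , inj₂ (there c)) = inj₁ (a<b , inj₂ c)

  boundary-∷⁻ : ∀ {p q b} → b ≢ q → Boundary ((p , q) ∷ L) b → Boundary L b
  boundary-∷⁻ {p} {q} {b} b≢q (a , a<b , known , unknown) with Known-∷⁻ known
  ... | inj₁ known′         = a , a<b , known′ , λ k → unknown (Known-∷ k)
  ... | inj₂ (p≤a , b≤q) = contradiction (m<n⇒m<1+n a<b , inj₂ (here (p≤a , ≤∧≢⇒< b≤q b≢q))) unknown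

  no-boundary-∷ : ∀ {p q y b} → Confined L p y → y < b → b < q → ¬ Boundary ((p , q) ∷ L) b
  no-boundary-∷ {p} conf y<b b<q (a , a<b , known , unknown) with p ≤? a
  ... | yes p≤a = unknown (m<n⇒m<1+n a<b , inj₂ (here (p≤a , b<q)))
  ... | no  p≰a with Known-∷⁻ known
  ...   | inj₁ known′    = <⇒≱ y<b (conf known′ (≰⇒> p≰a))
  ...   | inj₂ (p≤a , _) = p≰a p≤a

  boundary-above : ∀ {x y₁ y y′} → Confined L x y₁ → y₁ ≤ y → y < y′ → ¬ Known L y (suc y′) →
    ∃ λ b → y < b × b ≤ y′ × Boundary L b × (b ≡ y′ ⊎ ¬ Boundary ((x , y′) ∷ L) b)
  boundary-above {x} {y₁} {y} {y′} conf y₁≤y y<y′ unknown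
    with b , y<b , b<1+y′ , known , unknown′ ← crossing (Known? L y) (m≤n⇒m≤1+n y<y′) (≤-refl , inj₁ refl) unknown =
    b , y<b , s≤s⁻¹ b<1+y′ , (y , y<b , known , unknown′) , gone
    where
    gone : b ≡ y′ ⊎ ¬ Boundary ((x , y′) ∷ L) b
    gone with m≤n⇒m<n∨m≡n (s≤s⁻¹ b<1+y′)
    ... | inj₁ b<y′ = inj₂ (no-boundary-∷ conf (≤-<-trans y₁≤y y<b) b<y′)
    ... | inj₂ b≡y′ = inj₁ b≡y′

  potential-extend : ∀ {x y₁ y y′ k} → Confined L x y₁ → y₁ ≤ y → y < y′ → y′ ≤ k → ¬ Known L y (suc y′) →
    potential ((x , y′) ∷ L) k ≤ potential L k
  potential-extend {x} conf y₁≤y y<y′ y′≤k unknown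
    with b , _ , b≤y′ , boundary , b≡y′⊎gone ← boundary-above conf y₁≤y y<y′ unknown =
    count-exchange (Boundary? ((x , _) ∷ L)) (Boundary? L) (λ _ → boundary-∷⁻) (s≤s (≤-trans b≤y′ y′≤k)) boundary b≡y′⊎gone

  -- The interval now reaching y′ removes the boundary at y that the run had created.
  potential-extend-< : ∀ {x y₁ y y′ k} → Confined L x y₁ → x ≤ y₁ → y₁ < y → y < y′ → y′ ≤ k →
    Covered L x y → ¬ Known L x (suc y) → ¬ Known L y (suc y′) →
    suc (potential ((x , y′) ∷ L) k) ≤ potential L k
  potential-extend-< {x} {y₁} {y} {y′} {k} conf x≤y₁ y₁<y y<y′ y′≤k cov unknown-x unknown-y
    with b , y<b , b≤y′ , boundary , b≡y′⊎gone ← boundary-above conf (<⇒≤ y₁<y) y<y′ unknown-y = begin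
      suc (count B′? (suc k))       ≤⟨ count-strict B′? B′∪y? (λ _ → inj₁) y<1+k (inj₂ refl) y-gone ⟩
      count B′∪y? (suc k)           ≤⟨ count-exchange B′∪y? (Boundary? L) B′∪y⊆B∪y′ (s≤s (≤-trans b≤y′ y′≤k)) boundary b-gone ⟩
      count (Boundary? L) (suc k)   ∎
    where
    open ≤-Reasoning
    L′ = (x , y′) ∷ L
    B′? = Boundary? L′
    B′∪y? = B′? ∪? (_≟ y)
    y<1+k : y < suc k
    y<1+k = s≤s (≤-trans (<⇒≤ y<y′) y′≤k)
    x<y : x < y
    x<y = ≤-<-trans x≤y₁ y₁<y
    y-gone : ¬ Boundary L′ y
    y-gone = no-boundary-∷ conf y₁<y y<y′
    B′∪y⊆B∪y′ : ∀ {i} → i < suc k → i ≢ y′ → (Boundary L′ ∪ (_≡ y)) i → Boundary L i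
    B′∪y⊆B∪y′ _ i≢y′ (inj₁ bd)   = boundary-∷⁻ i≢y′ bd
    B′∪y⊆B∪y′ _ _    (inj₂ refl) = x , x<y , (x<y , inj₂ cov) , unknown-x
    b-gone : b ≡ y′ ⊎ ¬ (Boundary L′ ∪ (_≡ y)) b
    b-gone = map₂ (λ gone → [ gone , (λ b≡y → <-irrefl (sym b≡y) y<b) ]) b≡y′⊎gone

  Confined-unknown : ∀ {y y′} → y ≤ y′ → ¬ Known L y (suc y′) → Confined L (suc y) y′
  Confined-unknown y≤y′ unknown known a<1+y = ≮⇒≥ λ y′<b → unknown (Known-shrink known (s≤s⁻¹ a<1+y) (s≤s y≤y′) y′<b)

  Confined-∷ : ∀ {x y₁ q} → Confined L x y₁ → Confined ((x , q) ∷ L) x y₁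
  Confined-∷ conf known a<x with Known-∷⁻ known
  ... | inj₁ known′    = conf known′ a<x
  ... | inj₂ (x≤a , _) = contradiction x≤a (<⇒≱ a<x)

-- Phrase ends of w

module PhraseEnds {q : ℕ} (w : Word q) where

  n : ℕ
  n = length w

  -- endsFrom f m p: p is the last position of a phrase in the parse of w resumed at m (f is fuel).
  endsFrom : ℕ → ℕ → ℕ → Bool
  endsFrom zero    m p = false
  endsFrom (suc f) m p with m <? n
  ... | no  _ = false
  ... | yes _ with <-cmp (suc p) (m + phraseAt w m)
  ...   | tri< _ _ _ = false
  ...   | tri≈ _ _ _ = true
  ...   | tri> _ _ _ = endsFrom f (m + phraseAt w m) p

  module _ {f m p : ℕ} where

    endsFrom-done : ¬ m < n → ¬ T (endsFrom (suc f) m p)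
    endsFrom-done m≮n ends with m <? n
    ... | yes m<n = m≮n m<n

    endsFrom-inside : m < n → suc p < m + phraseAt w m → ¬ T (endsFrom (suc f) m p)
    endsFrom-inside m<n p<end ends with m <? n
    ... | no m≮n = m≮n m<n
    ... | yes _ with <-cmp (suc p) (m + phraseAt w m)
    ...   | tri≈ _ p≡end _ = <-irrefl p≡end p<end
    ...   | tri> _ _ p>end = <-asym p<end p>end

    endsFrom-last : m < n → suc p ≡ m + phraseAt w m → T (endsFrom (suc f) m p)
    endsFrom-last m<n p≡end with m <? n
    ... | no m≮n = contradiction m<n m≮n
    ... | yes _ with <-cmp (suc p) (m + phraseAt w m)
    ...   | tri< p<end _ _ = ⊥-elim (<-irrefl p≡end p<end)
    ...   | tri≈ _ _ _     = tt
    ...   | tri> _ _ p>end = ⊥-elim (<-irrefl (sym p≡end) p>end)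

    endsFrom-after : m < n → m + phraseAt w m < suc p → endsFrom (suc f) m p ≡ endsFrom f (m + phraseAt w m) p
    endsFrom-after m<n p>end with m <? n
    ... | no m≮n = contradiction m<n m≮n
    ... | yes _ with <-cmp (suc p) (m + phraseAt w m)
    ...   | tri< p<end _ _ = contradiction p>end (<-asym p<end)
    ...   | tri≈ _ p≡end _ = contradiction p>end (<-irrefl (sym p≡end))
    ...   | tri> _ _ _     = refl

  endsFrom-count : ∀ f m → count (T? ∘ endsFrom f m) n ≤ lzFrom w f m
  endsFrom-count zero    m = ≤-reflexive (count-none (T? ∘ endsFrom zero m) {n} λ _ ())
  endsFrom-count (suc f) m = by-cases (m <? n)
    where
    by-cases : Dec (m < n) → count (T? ∘ endsFrom (suc f) m) n ≤ lzFrom w (suc f) m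
    by-cases (no m≮n)  = ≤-trans (≤-reflexive (count-none (T? ∘ endsFrom (suc f) m) {n} λ _ → endsFrom-done m≮n)) z≤n
    by-cases (yes m<n) = begin
      count (T? ∘ endsFrom (suc f) m) n        ≤⟨ count-insert (T? ∘ endsFrom (suc f) m) (T? ∘ endsFrom f (m + ℓ)) later ⟩
      suc (count (T? ∘ endsFrom f (m + ℓ)) n)  ≤⟨ s≤s (endsFrom-count f (m + ℓ)) ⟩
      suc (lzFrom w f (m + ℓ))                 ≡⟨ lzFrom-step w f m<n ⟨
      lzFrom w (suc f) m                       ∎
      where
      open ≤-Reasoning
      ℓ = phraseAt w m
      later : ∀ {i} → i < n → i ≢ m + ℓ ∸ 1 → T (endsFrom (suc f) m i) → T (endsFrom f (m + ℓ) i)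
      later {i} _ i≢last ends with <-cmp (suc i) (m + ℓ)
      ... | tri< i<end _ _ = ⊥-elim (endsFrom-inside m<n i<end ends)
      ... | tri≈ _ i≡end _ = ⊥-elim (i≢last (cong (_∸ 1) i≡end))
      ... | tri> _ _ i>end = subst T (endsFrom-after m<n i>end) ends

  record PhraseCopy (E : ℕ → Bool) (a : ℕ) : Set where
    field
      end    : ℕ
      a<end  : a < end
      end<n  : end < n
      ends   : T (E end)
      no-end : ∀ {p} → a ≤ p → p < end → ¬ T (E p)
      copy   : OccursBefore w a (end ∸ a)

  PhraseCopy-cong : ∀ {E E′ a} → (∀ {p} → a ≤ p → E p ≡ E′ p) → PhraseCopy E a → PhraseCopy E′ a
  PhraseCopy-cong E≡E′ c = record
    { end    = end
    ; a<end  = a<end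
    ; end<n  = end<n
    ; ends   = subst T (E≡E′ (<⇒≤ a<end)) ends
    ; no-end = λ a≤p p<end → no-end a≤p p<end ∘ subst T (sym (E≡E′ a≤p))
    ; copy   = copy
    }
    where open PhraseCopy c

  endsFrom-copy : ∀ f m {a} → n ∸ m ≤ f → m ≤ a → a < n → ¬ T (endsFrom f m a) → PhraseCopy (endsFrom f m) a
  endsFrom-copy zero    m {a} n∸m≤0 m≤a a<n _ = ⊥-elim (<⇒≱ a<n (≤-trans (m∸n≡0⇒m≤n (n≤0⇒n≡0 n∸m≤0)) m≤a))
  endsFrom-copy (suc f) m {a} n∸m≤1+f m≤a a<n ¬ends = by-cases (<-cmp (suc a) (m + ℓ))
    where
    m<n = ≤-<-trans m≤a a<n
    ℓ = phraseAt w m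
    phrase = phraseAt-phrase w m<n
    open Phrase phrase
    last≡ : suc (m + (ℓ ∸ 1)) ≡ m + ℓ
    last≡ = trans (sym (+-suc m (ℓ ∸ 1))) (cong (m +_) (suc[ℓ∸1]≡ℓ nonempty))
    fuel : n ∸ (m + ℓ) ≤ f
    fuel = ≤-trans (≤-reflexive (sym (∸-+-assoc n m ℓ))) (≤-trans (∸-monoʳ-≤ (n ∸ m) nonempty) (∸-monoˡ-≤ 1 n∸m≤1+f))
    by-cases : Tri (suc a < m + ℓ) (suc a ≡ m + ℓ) (suc a > m + ℓ) → PhraseCopy (endsFrom (suc f) m) a
    by-cases (tri< a<end _ _) = record
      { end    = m + (ℓ ∸ 1)
      ; a<end  = s≤s⁻¹ (subst (suc a <_) (sym last≡) a<end)
      ; end<n  = <-≤-trans (subst (m + (ℓ ∸ 1) <_) last≡ ≤-refl) fits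
      ; ends   = endsFrom-last m<n last≡
      ; no-end = λ {p} _ p<end → endsFrom-inside m<n (subst (suc p <_) last≡ (s≤s p<end))
      ; copy   = occursBefore-suffix w m≤a (s≤s⁻¹ (subst (suc a ≤_) (sym last≡) (<⇒≤ a<end))) copied
      }
    by-cases (tri≈ _ a≡end _) = ⊥-elim (¬ends (endsFrom-last m<n a≡end))
    by-cases (tri> _ _ a>end) = PhraseCopy-cong (λ a≤p → sym (endsFrom-after {f} m<n (<-≤-trans a>end (s≤s a≤p))))
      (endsFrom-copy f (m + ℓ) fuel (s≤s⁻¹ a>end) a<n (¬ends ∘ subst T (sym (endsFrom-after {f} m<n a>end))))

-- Parsing the perturbed word

mismatch? : ∀ {q} (xs ys : Word q) → Decidable (λ p → at xs p ≢ at ys p)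
mismatch? xs ys p = ¬? (≡-dec Fin._≟_ (at xs p) (at ys p))

hamming≡count-mismatch : ∀ {q} (xs ys : Word q) → length ys ≡ length xs → hamming xs ys ≡ count (mismatch? xs ys) (length xs)
hamming≡count-mismatch []       ys       _   = refl
hamming≡count-mismatch (x ∷ xs) (y ∷ ys) |ys|≡|xs| = begin
  (if does (x Fin.≟ y) then 0 else 1) + hamming xs ys                         ≡⟨ cong₂ _+_ head (hamming≡count-mismatch xs ys (suc-injective |ys|≡|xs|)) ⟩
  count (mismatch? (x ∷ xs) (y ∷ ys)) 1 + count (mismatch? xs ys) (length xs)  ≡⟨ count-shift (mismatch? (x ∷ xs) (y ∷ ys)) (length xs) ⟨
  count (mismatch? (x ∷ xs) (y ∷ ys)) (suc (length xs))                        ∎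
  where
  open ≡-Reasoning
  head : (if does (x Fin.≟ y) then 0 else 1) ≡ count (mismatch? (x ∷ xs) (y ∷ ys)) 1
  head with x Fin.≟ y
  ... | yes _ = refl
  ... | no  _ = refl

module Perturbation {q : ℕ} (w w′ : Word q) (|w′|≡|w| : length w′ ≡ length w) where

  open PhraseEnds w using (n; endsFrom; PhraseCopy; endsFrom-count; endsFrom-copy)

  IsEnd : Pred ℕ 0ℓ
  IsEnd p = T (endsFrom n 0 p)

  isEnd? : Decidable IsEnd
  isEnd? p = T? (endsFrom n 0 p)

  PhraseCopyAt : ℕ → Set
  PhraseCopyAt = PhraseCopy (endsFrom n 0)

  copyAt : ∀ {a} → a < n → ¬ IsEnd a → PhraseCopyAt a
  copyAt = endsFrom-copy n 0 ≤-refl z≤n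

  source : ∀ {a} → PhraseCopyAt a → ℕ
  source c = proj₁ (PhraseCopy.copy c)

  no-copy-at-0 : ¬ PhraseCopyAt 0
  no-copy-at-0 c = <⇒≱ a<end (m+n≤o⇒n≤o (source c) (proj₁ (proj₂ copy)))
    where open PhraseCopy c

  Same : Pred ℕ 0ℓ
  Same p = at w p ≡ at w′ p

  Mismatch : Pred ℕ 0ℓ
  Mismatch p = at w p ≢ at w′ p

  ¬Mismatch⇒Same : ∀ {p} → ¬ Mismatch p → Same p
  ¬Mismatch⇒Same = decidable-stable (≡-dec Fin._≟_ _ _)

  N : ℕ → ℕ
  N = count (mismatch? w w′)

  k₀ : ℕ
  k₀ = N n

  N-mono : ∀ {r r′} → r ≤ r′ → N r ≤ N r′
  N-mono = count-monoʳ (mismatch? w w′)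

  N-flat : ∀ {a b p} → a ≤ p → p < b → N b ≤ N a → Same p
  N-flat a≤p p<b flat = ¬Mismatch⇒Same (count-flat (mismatch? w w′) a≤p p<b flat)

  N-cancel-< : ∀ {r r′} → N r < N r′ → r < r′
  N-cancel-< {r} {r′} N<N = ≰⇒> (λ r′≤r → <⇒≱ N<N (N-mono r′≤r))

  Anchor : Pred ℕ 0ℓ
  Anchor = IsEnd ∪ Mismatch

  AnchorFrom : ℕ → Pred ℕ 0ℓ
  AnchorFrom s p = s ≤ p × Anchor p

  anchorFrom? : ∀ s → Decidable (AnchorFrom s)
  anchorFrom? s p = (s ≤? p) ×-dec (isEnd? ∪? mismatch? w w′) p

  anchorsFrom : ℕ → ℕ
  anchorsFrom s = count (anchorFrom? s) n

  anchorsFrom-antitone : ∀ {s s′} → s ≤ s′ → anchorsFrom s′ ≤ anchorsFrom s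
  anchorsFrom-antitone s≤s′ = count-mono (anchorFrom? _) (anchorFrom? _) {n} λ _ (s′≤p , anchor) → ≤-trans s≤s′ s′≤p , anchor

  anchorsFrom-drop : ∀ {s s′ p} → s ≤ p → p < s′ → p < n → Anchor p → suc (anchorsFrom s′) ≤ anchorsFrom s
  anchorsFrom-drop s≤p p<s′ p<n anchor = count-strict (anchorFrom? _) (anchorFrom? _) {n}
    (λ _ (s′≤p , anchor) → ≤-trans (≤-trans s≤p (<⇒≤ p<s′)) s′≤p , anchor) p<n (s≤p , anchor) λ (s′≤p , _) → <⇒≱ p<s′ s′≤p

  anchorsFrom-0 : anchorsFrom 0 ≤ C-LZ77 w + k₀
  anchorsFrom-0 = ≤-trans (count-∪ (anchorFrom? 0) isEnd? (mismatch? w w′) {n} λ _ → proj₂)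
    (+-monoˡ-≤ k₀ (endsFrom-count n 0))

  -- Transcribed a b s: strictly between the a-th and the b-th mismatch (counting from 1),
  -- w has been copied into w′[0, s) with a fixed shift.
  Transcribed : ℕ → ℕ → ℕ → Set
  Transcribed a b s = ∃ λ d → ∀ {r} → a ≤ N r → N (suc r) < b → r + d < s × at w′ (r + d) ≡ at w r

  Sound : List Interval → ℕ → Set
  Sound L s = ∀ {a b} → Covered L a b → Transcribed a b s

  Sound-mono : ∀ {L s s′} → s ≤ s′ → Sound L s → Sound L s′
  Sound-mono s≤s′ sound cov with d , copied ← sound cov =
    d , λ a≤r r<b → let r+d<s , eq = copied a≤r r<b in <-≤-trans r+d<s s≤s′ , eq

  record Window (s ℓ u : ℕ) : Set where
    field
      nonempty : 1 ≤ ℓ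
      before   : u + ℓ ≤ s
      agrees   : ∀ {t} → t < ℓ → at w (u + t) ≡ at w′ (s + t)
      new      : ¬ OccursBefore w′ s ℓ

  module _ {s ℓ u : ℕ} (window : Window s ℓ u) where
    open Window window

    window-mismatch : N u < N (u + ℓ)
    window-mismatch = ≰⇒> λ flat → new (u , before , λ t t<ℓ →
      trans (sym (N-flat (m≤m+n u t) (+-monoʳ-< u t<ℓ) flat)) (agrees t<ℓ))

    window-unknown : ∀ {L} → Sound L s → ¬ Known L (N u) (suc (N (u + ℓ)))
    window-unknown sound (_ , inj₁ eq)  = <-irrefl (sym (suc-injective eq)) window-mismatch
    window-unknown sound (_ , inj₂ cov) with d , copied ← sound cov = new (u + d , fits , agrees′)
      where
      inside : ∀ {t} → t < ℓ → u + t + d < s × at w′ (u + t + d) ≡ at w (u + t)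
      inside {t} t<ℓ = copied (N-mono (m≤m+n u t)) (s≤s (N-mono (subst (_≤ u + ℓ) (+-suc u t) (+-monoʳ-≤ u t<ℓ))))
      shift : ∀ t → u + t + d ≡ u + d + t
      shift t = trans (+-assoc u t d) (trans (cong (u +_) (+-comm t d)) (sym (+-assoc u d t)))
      fits : u + d + ℓ ≤ s
      fits = begin
        u + d + ℓ              ≡⟨ cong (u + d +_) (suc[ℓ∸1]≡ℓ nonempty) ⟨
        u + d + suc (ℓ ∸ 1)    ≡⟨ +-suc (u + d) (ℓ ∸ 1) ⟩
        suc (u + d + (ℓ ∸ 1))  ≡⟨ cong suc (shift (ℓ ∸ 1)) ⟨
        suc (u + (ℓ ∸ 1) + d)  ≤⟨ proj₁ (inside (∸1< nonempty)) ⟩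
        s                      ∎
        where open ≤-Reasoning
      agrees′ : ∀ t → t < ℓ → at w′ (u + d + t) ≡ at w′ (s + t)
      agrees′ t t<ℓ = trans (cong (at w′) (sym (shift t))) (trans (proj₂ (inside t<ℓ)) (agrees t<ℓ))

  record InRun (a : ℕ) (c : PhraseCopyAt a) (s : ℕ) : Set where
    field
      a≤s   : a ≤ s
      s≤end : s ≤ PhraseCopy.end c
      same  : ∀ {p} → a ≤ p → p < s → Same p

  -- The run from a has transcribed w[source c, source c + (s ∸ a)) into w′[a, s); first c and
  -- reach a c s index the outermost mismatches inside that window.
  first : ∀ {a} → PhraseCopyAt a → ℕ
  first c = suc (N (source c))

  reach : ∀ a → PhraseCopyAt a → ℕ → ℕ
  reach a c s = N (source c + (s ∸ a))

  run-transcribed : ∀ {a c s} → InRun a c s → Transcribed (first c) (reach a c s) s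
  run-transcribed {a} {c} {s} run = a ∸ source c , transcribed
    where
    open PhraseCopy c
    open InRun run
    source≤a : source c ≤ a
    source≤a = ≤-trans (m≤m+n (source c) (end ∸ a)) (proj₁ (proj₂ copy))
    transcribed : ∀ {r} → first c ≤ N r → N (suc r) < reach a c s → r + (a ∸ source c) < s × at w′ (r + (a ∸ source c)) ≡ at w r
    transcribed {r} first≤N N<reach with t , refl ← m≤n⇒∃[o]m+o≡n (<⇒≤ (N-cancel-< {source c} {r} first≤N)) = a+t<s , agrees
      where
      r+d≡a+t : source c + t + (a ∸ source c) ≡ a + t
      r+d≡a+t = trans (+-assoc (source c) t _) (trans (cong (source c +_) (+-comm t _))
        (trans (sym (+-assoc (source c) _ t)) (cong (_+ t) (m+[n∸m]≡n source≤a))))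
      t<s∸a : t < s ∸ a
      t<s∸a = +-cancelˡ-< (source c) t (s ∸ a) (<-trans (n<1+n _) (N-cancel-< N<reach))
      a+t<s : source c + t + (a ∸ source c) < s
      a+t<s = subst (_< s) (sym r+d≡a+t) (subst (a + t <_) (m+[n∸m]≡n a≤s) (+-monoʳ-< a t<s∸a))
      agrees : at w′ (source c + t + (a ∸ source c)) ≡ at w (source c + t)
      agrees = begin
        at w′ (source c + t + (a ∸ source c))  ≡⟨ cong (at w′) r+d≡a+t ⟩
        at w′ (a + t)                          ≡⟨ same (m≤m+n a t) (subst (_< s) r+d≡a+t a+t<s) ⟨
        at w (a + t)                           ≡⟨ proj₂ (proj₂ copy) t (<-≤-trans t<s∸a (∸-monoˡ-≤ a s≤end)) ⟨
        at w (source c + t)                    ∎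
        where open ≡-Reasoning

  record Progress (L : List Interval) (a : ℕ) (c : PhraseCopyAt a) (s ℓ : ℕ) : Set where
    field
      run′    : InRun a c (s + ℓ)
      grows   : reach a c s < reach a c (s + ℓ)
      unknown : ¬ Known L (reach a c s) (suc (reach a c (s + ℓ)))
      bounded : reach a c (s + ℓ) ≤ k₀

  progress : ∀ {a c s L} → Sound L s → InRun a c s → (∀ {p} → s ≤ p → p < s + phraseAt w′ s → ¬ Anchor p) →
    s < n → Progress L a c s (phraseAt w′ s)
  progress {a} {c} {s} sound run free s<n = record
    { run′    = record { a≤s = ≤-trans a≤s (m≤m+n s ℓ) ; s≤end = s+ℓ≤end ; same = same′ }
    ; grows   = subst (reach a c s <_) (sym reach≡) (window-mismatch window)
    ; unknown = subst (λ y′ → ¬ Known _ (reach a c s) (suc y′)) (sym reach≡) (window-unknown window sound)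
    ; bounded = subst (_≤ k₀) (sym reach≡) (N-mono (≤-trans before (<⇒≤ s<n)))
    }
    where
    ℓ = phraseAt w′ s
    open PhraseCopy c
    open InRun run
    open Phrase (phraseAt-phrase w′ (subst (s <_) (sym |w′|≡|w|) s<n))
    s+ℓ≤end : s + ℓ ≤ end
    s+ℓ≤end = ≮⇒≥ λ end<s+ℓ → free s≤end end<s+ℓ (inj₁ ends)
    s+ℓ<|w′| : s + ℓ < length w′
    s+ℓ<|w′| = subst (s + ℓ <_) (sym |w′|≡|w|) (≤-<-trans s+ℓ≤end end<n)
    same′ : ∀ {p} → a ≤ p → p < s + ℓ → Same p
    same′ {p} a≤p p<s+ℓ with p <? s
    ... | yes p<s = same a≤p p<s
    ... | no  p≮s = ¬Mismatch⇒Same (free (≮⇒≥ p≮s) p<s+ℓ ∘ inj₂)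
    before : source c + (s ∸ a) + ℓ ≤ s
    before = begin
      source c + (s ∸ a) + ℓ    ≡⟨ +-assoc (source c) (s ∸ a) ℓ ⟩
      source c + ((s ∸ a) + ℓ)  ≡⟨ cong (source c +_) (+-∸-comm ℓ a≤s) ⟨
      source c + (s + ℓ ∸ a)    ≤⟨ +-monoʳ-≤ (source c) (∸-monoˡ-≤ a s+ℓ≤end) ⟩
      source c + (end ∸ a)      ≤⟨ proj₁ (proj₂ copy) ⟩
      a                         ≤⟨ a≤s ⟩
      s                         ∎
      where open ≤-Reasoning
    agrees : ∀ {t} → t < ℓ → at w (source c + (s ∸ a) + t) ≡ at w′ (s + t)
    agrees {t} t<ℓ = begin
      at w (source c + (s ∸ a) + t)    ≡⟨ cong (at w) (+-assoc (source c) (s ∸ a) t) ⟩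
      at w (source c + ((s ∸ a) + t))  ≡⟨ proj₂ (proj₂ copy) ((s ∸ a) + t) inside ⟩
      at w (a + ((s ∸ a) + t))         ≡⟨ cong (at w) (trans (sym (+-assoc a (s ∸ a) t)) (cong (_+ t) (m+[n∸m]≡n a≤s))) ⟩
      at w (s + t)                     ≡⟨ same′ (≤-trans a≤s (m≤m+n s t)) (+-monoʳ-< s t<ℓ) ⟩
      at w′ (s + t)                    ∎
      where
      open ≡-Reasoning
      inside : (s ∸ a) + t < end ∸ a
      inside = <-≤-trans (subst (_< s + ℓ ∸ a) (+-∸-comm t a≤s) (∸-monoˡ-< (+-monoʳ-< s t<ℓ) (≤-trans a≤s (m≤m+n s t)))) (∸-monoˡ-≤ a s+ℓ≤end)
    window : Window s ℓ (source c + (s ∸ a))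
    window = record { nonempty = nonempty ; before = before ; agrees = agrees ; new = new s+ℓ<|w′| }
    reach≡ : reach a c (s + ℓ) ≡ N (source c + (s ∸ a) + ℓ)
    reach≡ = cong N (trans (cong (source c +_) (+-∸-comm ℓ a≤s)) (sym (+-assoc (source c) (s ∸ a) ℓ)))

  -- fresh: the last phrase contained an anchor. run₁ a c, run₂ a c y₁: the last one, resp. the last
  -- two or more, phrases were anchor-free and lie in the phrase of w through a; y₁ is the reach
  -- after the first of them.
  data Phase : Set where
    initial fresh : Phase
    run₁        : ∀ a → PhraseCopyAt a → Phase
    run₂        : ∀ a → PhraseCopyAt a → ℕ → Phase

  credit : Phase → ℕ
  credit initial      = 0
  credit fresh        = 2
  credit (run₁ _ _)   = 1
  credit (run₂ _ _ _) = 0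

  PhaseInv : ℕ → List Interval → Phase → Set
  PhaseInv s L initial       = s ≡ 0
  PhaseInv s L fresh         = ⊤
  PhaseInv s L (run₁ a c)    = InRun a c s × first c ≤ reach a c s × Confined L (first c) (reach a c s)
  PhaseInv s L (run₂ a c y₁) = InRun a c s × first c ≤ y₁ × Confined L (first c) y₁ × y₁ < reach a c s ×
                               Covered L (first c) (reach a c s) × ¬ Known L (first c) (suc (reach a c s))

  budget : ℕ → List Interval → Phase → ℕ
  budget s L ph = 3 * anchorsFrom s + (potential L k₀ + credit ph)

  record Step (s ℓ : ℕ) (L : List Interval) (ph : Phase) : Set where
    field
      L′     : List Interval
      ph′    : Phase
      sound′ : Sound L′ (s + ℓ)
      inv′   : PhaseInv (s + ℓ) L′ ph′
      pays   : budget (s + ℓ) L′ ph′ < budget s L ph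

  pays-anchored : ∀ {A′ A P c} → A′ < A → 3 * A′ + (P + 2) < 3 * A + (P + c)
  pays-anchored {A′} {A} {P} {c} A′<A = begin-strict
    3 * A′ + (P + 2)   <⟨ +-monoʳ-< (3 * A′) (+-monoʳ-< P ≤-refl) ⟩
    3 * A′ + (P + 3)   ≡⟨ regroup A′ P ⟩
    3 * suc A′ + P     ≤⟨ +-monoˡ-≤ P (*-monoʳ-≤ 3 A′<A) ⟩
    3 * A + P          ≤⟨ +-monoʳ-≤ (3 * A) (m≤m+n P c) ⟩
    3 * A + (P + c)    ∎
    where
    open ≤-Reasoning
    regroup : ∀ a p → 3 * a + (p + 3) ≡ 3 * suc a + p
    regroup = solve-∀

  pays-unanchored : ∀ {s s′ L L′} ph ph′ → s ≤ s′ → potential L′ k₀ + credit ph′ < potential L k₀ + credit ph →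
    budget s′ L′ ph′ < budget s L ph
  pays-unanchored _ _ s≤s′ = +-mono-≤-< (*-monoʳ-≤ 3 (anchorsFrom-antitone s≤s′))

  anchored-step : ∀ {s ℓ L ph p} → Sound L s → s ≤ p → p < s + ℓ → p < n → Anchor p → Step s ℓ L ph
  anchored-step {s} {ℓ} sound s≤p p<s+ℓ p<n anchor = record
    { L′ = _ ; ph′ = fresh ; sound′ = Sound-mono (m≤m+n s ℓ) sound ; inv′ = tt
    ; pays = pays-anchored (anchorsFrom-drop s≤p p<s+ℓ p<n anchor)
    }

  extend-run : ∀ {a c s L y₁ y} → Sound L s → InRun a c s → first c ≤ y₁ → Confined L (first c) y₁ → y₁ ≤ y →
    y < reach a c s → ¬ Known L y (suc (reach a c s)) →
    let L′ = (first c , reach a c s) ∷ L in Sound L′ s × PhaseInv s L′ (run₂ a c y₁)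
  extend-run {a} {c} {s} {L} {y₁} {y} sound run x≤y₁ conf y₁≤y y<y′ unknown =
    sound′ , run , x≤y₁ , Confined-∷ conf , y₁<y′ , here (≤-refl , ≤-refl) , unknown′
    where
    x = first c
    y′ = reach a c s
    y₁<y′ : y₁ < y′
    y₁<y′ = ≤-<-trans y₁≤y y<y′
    sound′ : Sound ((x , y′) ∷ L) s
    sound′ (here (x≤a , b≤y′)) with d , copied ← run-transcribed run =
      d , λ a≤N N<b → copied (≤-trans x≤a a≤N) (<-≤-trans N<b b≤y′)
    sound′ (there cov) = sound cov
    unknown′ : ¬ Known ((x , y′) ∷ L) x (suc y′)
    unknown′ known with Known-∷⁻ (Known-shrink known (≤-trans x≤y₁ y₁≤y) (m<n⇒m<1+n y<y′) ≤-refl)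
    ... | inj₁ known′     = unknown known′
    ... | inj₂ (_ , y′<y′) = <-irrefl refl y′<y′

  unanchored-step : ∀ {s L} ph → s < n → Sound L s → PhaseInv s L ph →
    (∀ {p} → s ≤ p → p < s + phraseAt w′ s → ¬ Anchor p) → Step s (phraseAt w′ s) L ph
  unanchored-step {s} {L} ph s<n sound inv free = by-phase ph inv
    where
    ℓ = phraseAt w′ s
    s<s+ℓ : s < s + ℓ
    s<s+ℓ = m<m+n s (Phrase.nonempty (phraseAt-phrase w′ (subst (s <_) (sym |w′|≡|w|) s<n)))
    c₀ : PhraseCopyAt s
    c₀ = copyAt s<n (free ≤-refl s<s+ℓ ∘ inj₁)
    by-phase : ∀ ph → PhaseInv s L ph → Step s ℓ L ph
    by-phase initial s≡0 = ⊥-elim (no-copy-at-0 (subst PhraseCopyAt s≡0 c₀))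
    by-phase fresh _ = record
      { L′ = L ; ph′ = run₁ s c₀ ; sound′ = Sound-mono (m≤m+n s ℓ) sound
      ; inv′ = run′ , subst (_≤ reach s c₀ (s + ℓ)) y≡ grows
             , subst (λ x → Confined L x (reach s c₀ (s + ℓ))) y≡ (Confined-unknown (<⇒≤ grows) unknown)
      ; pays = pays-unanchored fresh (run₁ s c₀) (m≤m+n s ℓ) (+-monoʳ-< (potential L k₀) ≤-refl)
      }
      where
      run : InRun s c₀ s
      run = record { a≤s = ≤-refl ; s≤end = <⇒≤ (PhraseCopy.a<end c₀) ; same = λ s≤p p<s → contradiction p<s (≤⇒≯ s≤p) }
      open Progress (progress sound run free s<n)
      y≡ : suc (reach s c₀ s) ≡ first c₀
      y≡ = cong (suc ∘ N) (trans (cong (source c₀ +_) (n∸n≡0 s)) (+-identityʳ (source c₀)))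
    by-phase (run₁ a c) (run , x≤y₁ , conf) = record
      { L′ = _ ; ph′ = run₂ a c (reach a c s) ; sound′ = proj₁ extended ; inv′ = proj₂ extended
      ; pays = pays-unanchored (run₁ a c) (run₂ a c (reach a c s)) (m≤m+n s ℓ) (+-mono-≤-< (potential-extend conf ≤-refl grows bounded unknown) z<s)
      }
      where
      open Progress (progress sound run free s<n)
      extended = extend-run (Sound-mono (m≤m+n s ℓ) sound) run′ x≤y₁ conf ≤-refl grows unknown
    by-phase (run₂ a c y₁) (run , x≤y₁ , conf , y₁<y , covered , unknown-x) = record
      { L′ = _ ; ph′ = run₂ a c y₁ ; sound′ = proj₁ extended ; inv′ = proj₂ extended
      ; pays = pays-unanchored (run₂ a c y₁) (run₂ a c y₁) (m≤m+n s ℓ) (+-monoˡ-< 0 (potential-extend-< conf x≤y₁ y₁<y grows bounded covered unknown-x unknown))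
      }
      where
      open Progress (progress sound run free s<n)
      extended = extend-run (Sound-mono (m≤m+n s ℓ) sound) run′ x≤y₁ conf (<⇒≤ y₁<y) grows unknown

  phrase-step : ∀ {s L} ph → s < n → Sound L s → PhaseInv s L ph → Step s (phraseAt w′ s) L ph
  phrase-step {s} ph s<n sound inv with anyUpTo? (anchorFrom? s) (s + phraseAt w′ s)
  ... | yes (p , p<s+ℓ , s≤p , anchor) = anchored-step sound s≤p p<s+ℓ p<n anchor
    where
    p<n : p < n
    p<n = <-≤-trans p<s+ℓ (subst (s + phraseAt w′ s ≤_) |w′|≡|w|
      (Phrase.fits (phraseAt-phrase w′ (subst (s <_) (sym |w′|≡|w|) s<n))))
  ... | no none = unanchored-step ph s<n sound inv λ s≤p p<s+ℓ anchor → none (_ , p<s+ℓ , s≤p , anchor)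

  parse-bound : ∀ f s L ph → Sound L s → PhaseInv s L ph → lzFrom w′ f s ≤ budget s L ph
  parse-bound zero    s L ph _     _   = z≤n
  parse-bound (suc f) s L ph sound inv with s <? n
  ... | no  s≮n = ≤-trans (≤-reflexive (lzFrom-done w′ (suc f) (subst (_≤ s) (sym |w′|≡|w|) (≮⇒≥ s≮n)))) z≤n
  ... | yes s<n = begin
    lzFrom w′ (suc f) s                ≡⟨ lzFrom-step w′ f (subst (s <_) (sym |w′|≡|w|) s<n) ⟩
    suc (lzFrom w′ f (s + ℓ))          ≤⟨ s≤s (parse-bound f (s + ℓ) L′ ph′ sound′ inv′) ⟩
    suc (budget (s + ℓ) L′ ph′)        ≤⟨ pays ⟩
    budget s L ph                      ∎
    where
    open ≤-Reasoning
    ℓ = phraseAt w′ s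
    open Step (phrase-step ph s<n sound inv)

  C-LZ77-bound : C-LZ77 w′ ≤ 3 * C-LZ77 w + 4 * k₀
  C-LZ77-bound = begin
    C-LZ77 w′                                  ≤⟨ parse-bound (length w′) 0 [] initial (λ ()) refl ⟩
    3 * anchorsFrom 0 + (potential [] k₀ + 0)  ≤⟨ +-mono-≤ (*-monoʳ-≤ 3 anchorsFrom-0) (≤-trans (≤-reflexive (+-identityʳ _)) (potential-≤ k₀)) ⟩
    3 * (C-LZ77 w + k₀) + k₀                   ≡⟨ regroup (C-LZ77 w) k₀ ⟩
    3 * C-LZ77 w + 4 * k₀                      ∎
    where
    open ≤-Reasoning
    regroup : ∀ c k → 3 * (c + k) + k ≡ 3 * c + 4 * k
    regroup = solve-∀

theorem1 : (q : ℕ) (k : ℕ) (w w' : Word q) → w' ∈B[ w , k ] →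
    C-LZ77 w' ≤ 3 * C-LZ77 w + 4 * k
theorem1 q k w w' (inBall |w'|≡|w| dist≤k) = begin
  C-LZ77 w'                ≤⟨ Perturbation.C-LZ77-bound w w' |w'|≡|w| ⟩
  3 * C-LZ77 w + 4 * k₀    ≤⟨ +-monoʳ-≤ (3 * C-LZ77 w) (*-monoʳ-≤ 4 k₀≤k) ⟩
  3 * C-LZ77 w + 4 * k     ∎
  where
  open ≤-Reasoning
  k₀ = count (mismatch? w w') (length w)
  k₀≤k : k₀ ≤ k
  k₀≤k = subst (_≤ k) (hamming≡count-mismatch w w' |w'|≡|w|) dist≤k
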